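{- Let $G=(V,E,L)$ be a rigid $\mathcal{M}_{lc}$-circuit. Then $V_3\ne\emptyset$, and the graph obtained from the subgraph $G[V_3]$ induced by $V_3$ by deleting all its loops is a forest.
   Context: A looped simple graph $G=(V,E,L)$: $E$ is a set of non-loop edges with no parallel edges, $L$ a set of loops (several may be at one vertex). For $X\subseteq V$, $i_E(X)$, $i_L(X)$ are the numbers of edges, resp. loops, induced by $X$, and $i_{E\cup L}(X)=i_E(X)+i_L(X)$. $G$ is a rigid $\mathcal{M}_{lc}$-circuit if $|E|+|L|=2|V|+1$, $i_E(X)\le2|X|-3$ for all $X\subseteq V$ with $|X|\ge2$, and $i_{E\cup L}(X)\le 2|X|$ for all $X\subsetneq V$. For $v\in V$, $d^\dagger(v)$ is the number of edges or loops incident to $v$ (each loop counted once), and $V_3=\{v\in V: d^\dagger(v)=3\}$. -}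

module Defs where

open import Data.Nat using (ℕ; suc; _+_; _*_; _≤_; _<_)
open import Data.Fin using (Fin; toℕ)
open import Data.Fin.Subset using (Subset; _∈_; _∉_; ∣_∣)
open import Data.Fin.Subset.Properties using (_∈?_)
open import Data.Fin.Properties using () renaming (_≟_ to _≟ᶠ_)
open import Data.List using (List; []; _∷_; length; filter; _++_; [_])
open import Data.List.Relation.Unary.All using (All)
open import Data.List.Relation.Unary.Unique.Propositional using (Unique)
open import Data.List.Relation.Unary.Linked using (Linked)
open import Data.List.Membership.Propositional using () renaming (_∈_ to _∈ₗ_)
open import Data.Product using (_×_; _,_; proj₁; proj₂; ∃; Σ)
open import Data.Product.Properties using ()
open import Data.Sum using (_⊎_)
open import Relation.Nullary using (¬_; _×-dec_; _⊎-dec_)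
open import Relation.Binary.PropositionalEquality using (_≡_)

-- Non-loop edges: a list of pairs (u , v) stored in canonical orientation
-- toℕ u < toℕ v (so no loops among them); no parallel edges = the list has
-- no repetitions. Loops: a list of vertices, one entry per loop (several
-- loops may sit at one vertex, each being a distinct list entry).
Edge : ℕ → Set
Edge n = Fin n × Fin n

record LoopedGraph (n : ℕ) : Set where
  constructor mkGraph
  field
    E        : List (Edge n)
    L        : List (Fin n)
    E-proper : All (λ e → toℕ (proj₁ e) < toℕ (proj₂ e)) E
    E-simple : Unique E
open LoopedGraph public

module _ {n : ℕ} (G : LoopedGraph n) where

  iE : Subset n → ℕ
  iE X = length (filter (λ e → (proj₁ e ∈? X) ×-dec (proj₂ e ∈? X)) (E G))

  iL : Subset n → ℕ
  iL X = length (filter (λ v → v ∈? X) (L G))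

  iEL : Subset n → ℕ
  iEL X = iE X + iL X

  record RigidCircuit : Set where
    field
      count   : length (E G) + length (L G) ≡ 2 * n + 1
      sparseE : ∀ (X : Subset n) → 2 ≤ ∣ X ∣ → iE X + 3 ≤ 2 * ∣ X ∣
      sparseEL : ∀ (X : Subset n) → (∃ λ v → v ∉ X) → iEL X ≤ 2 * ∣ X ∣

  -- d†(v): number of edges or loops incident to v (each loop counted once)
  deg : Fin n → ℕ
  deg v = length (filter (λ e → (proj₁ e ≟ᶠ v) ⊎-dec (proj₂ e ≟ᶠ v)) (E G))
        + length (filter (λ w → w ≟ᶠ v) (L G))

  InV3 : Fin n → Set
  InV3 v = deg v ≡ 3

  Adj : Fin n → Fin n → Set
  Adj u v = ((u , v) ∈ₗ E G) ⊎ ((v , u) ∈ₗ E G)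

  -- A cycle in the loopless graph G[V₃] − L: distinct vertices
  -- v ∷ rest (at least 3 of them), all in V₃, with consecutive ones adjacent
  -- and the last adjacent to v.
  record V3Cycle : Set where
    field
      v     : Fin n
      rest  : List (Fin n)
      long  : 2 ≤ length rest
      dist  : Unique (v ∷ rest)
      inV3  : All InV3 (v ∷ rest)
      walk  : Linked Adj (v ∷ rest ++ [ v ])

  V3Forest : Set
  V3Forest = ¬ V3Cycle

module Submission where

-- Everything rests on the
-- peeling lemma: deleting w from X loses at most d†(w) induced edges and
-- loops, and none of the edges at w that already leave X,
--     i_{E∪L}(X) + out(X, w) ≤ i_{E∪L}(X − w) + d†(w).
-- (1) Peeling any w from V gives 2n + 1 ≤ 2(n − 1) + d†(w), so d†(w) ≥ 3.
--     If no degree were 3, the handshake identity Σ d† = 2|E| + |L| ≥ 4n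
--     would contradict |E| + |L| = 2n + 1 and |E| ≤ 2n − 2.
-- (2) For a cycle v w₁ … w_k v in V₃, peel v and then w₁, …, w_k: each wᵢ
--     has an already deleted neighbour and w_k has two, so the final set
--     Y ∌ v has i_{E∪L}(Y) > 2|Y|, contradicting the circuit condition.

open import Defs
open import Data.Nat using (ℕ; zero; suc; _+_; _*_; _≤_; _<_; z≤n; s≤s; _≟_)
open import Data.Nat.Properties
open import Data.Nat.Tactic.RingSolver using (solve-∀)
open import Algebra.Properties.CommutativeSemigroup +-commutativeSemigroup
  using (interchange; xy∙z≈xz∙y)
open import Algebra.Properties.CommutativeMonoid.Sum +-0-commutativeMonoid
  using (sum-syntax; ∑-distrib-+; sum-cong-≗; sum-replicate-zero)
open import Data.Bool using (if_then_else_; true; false)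
open import Data.Fin using (Fin; toℕ) renaming (zero to fzero; suc to fsuc)
open import Data.Fin.Properties using (any?) renaming (_≟_ to _≟ᶠ_)
open import Data.Fin.Subset using (Subset; _∈_; _∉_; ∣_∣; ⊤; _-_; ⁅_⁆)
open import Data.Fin.Subset.Properties
  using (_∈?_; ∈⊤; ∣⊤∣≡n; x∈p∧x≢y⇒x∈p-y; x∈p⇒∣p-x∣<∣p∣; p─q⊆p)
open import Data.Vec using (there; _∷_)
open import Data.List using (List; []; _∷_; length; filter; _++_; [_])
open import Data.List.Properties using (filter-all)
open import Data.List.Membership.Propositional using () renaming (_∈_ to _∈ₗ_)
open import Data.List.Membership.Propositional.Properties using (∈-filter⁺; ∈-length)
open import Data.List.Relation.Unary.All as All using (All; []; _∷_)
open import Data.List.Relation.Unary.Any using (here; there)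
open import Data.List.Relation.Unary.AllPairs using (_∷_)
open import Data.List.Relation.Unary.Unique.Propositional using (Unique)
open import Data.List.Relation.Unary.Linked using (Linked; [-]; _∷_)
open import Data.Product using (_×_; _,_; proj₁; proj₂; ∃)
open import Data.Sum using (_⊎_; inj₁; inj₂; fromInj₁)
open import Data.Empty using (⊥-elim)
open import Function using (_∘_)
open import Relation.Nullary using (¬_; Dec; yes; no; does; _×-dec_; _⊎-dec_; ¬?; contradiction)
open import Relation.Unary using (Decidable)
open import Relation.Binary.PropositionalEquality
  using (_≡_; _≢_; refl; sym; trans; cong; cong₂; subst; subst₂)
open ≤-Reasoning

≤-cancel-+ : ∀ a b k j → a + j ≤ b + (k + j) → a ≤ b + k
≤-cancel-+ a b k j h = +-cancelʳ-≤ j a (b + k) (subst (a + j ≤_) (sym (+-assoc b k j)) h)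

𝟙 : {P : Set} → Dec P → ℕ
𝟙 d = if does d then 1 else 0

𝟙-⊎ : {P Q : Set} (p : Dec P) (q : Dec Q) → ¬ (P × Q) → 𝟙 (p ⊎-dec q) ≡ 𝟙 p + 𝟙 q
𝟙-⊎ (yes p) (yes q) excl = contradiction (p , q) excl
𝟙-⊎ (yes _) (no _)  _    = refl
𝟙-⊎ (no _)  (yes _) _    = refl
𝟙-⊎ (no _)  (no _)  _    = refl

-- Pointwise form of the peeling inequality: if P ∧ ¬S implies R, then
-- [P] + [S ∧ ¬P] ≤ [R] + [S].
𝟙-cover : {P R S : Set} (p : Dec P) (r : Dec R) (s : Dec S) →
          (P → ¬ S → R) → 𝟙 p + 𝟙 (s ×-dec ¬? p) ≤ 𝟙 r + 𝟙 s
𝟙-cover (yes _) r       (yes _) _ = m≤n+m 1 (𝟙 r)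
𝟙-cover (yes _) (yes _) (no _)  _ = s≤s z≤n
𝟙-cover (yes p) (no ¬r) (no ¬s) f = contradiction (f p ¬s) ¬r
𝟙-cover (no _)  r       (yes _) _ = m≤n+m 1 (𝟙 r)
𝟙-cover (no _)  _       (no _)  _ = z≤n

module _ {A : Set} where

  count : {P : A → Set} → Decidable P → List A → ℕ
  count P? xs = length (filter P? xs)

  count-∷ : {P : A → Set} (P? : Decidable P) (x : A) (xs : List A) →
            count P? (x ∷ xs) ≡ 𝟙 (P? x) + count P? xs
  count-∷ P? x xs with does (P? x)
  ... | true  = refl
  ... | false = refl

  count-cover : {P R S : A → Set} (P? : Decidable P) (R? : Decidable R) (S? : Decidable S) →
                (∀ x → P x → ¬ S x → R x) → ∀ xs →
                count P? xs + count (λ x → S? x ×-dec ¬? (P? x)) xs ≤ count R? xs + count S? xs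
  count-cover P? R? S? cover [] = z≤n
  count-cover P? R? S? cover (x ∷ xs) = begin
    count P? (x ∷ xs) + count Q? (x ∷ xs)
      ≡⟨ cong₂ _+_ (count-∷ P? x xs) (count-∷ Q? x xs) ⟩
    (𝟙 (P? x) + count P? xs) + (𝟙 (Q? x) + count Q? xs)
      ≡⟨ interchange (𝟙 (P? x)) _ _ _ ⟩
    (𝟙 (P? x) + 𝟙 (Q? x)) + (count P? xs + count Q? xs)
      ≤⟨ +-mono-≤ (𝟙-cover (P? x) (R? x) (S? x) (cover x)) (count-cover P? R? S? cover xs) ⟩
    (𝟙 (R? x) + 𝟙 (S? x)) + (count R? xs + count S? xs)
      ≡⟨ interchange (𝟙 (R? x)) _ _ _ ⟩
    (𝟙 (R? x) + count R? xs) + (𝟙 (S? x) + count S? xs)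
      ≡⟨ sym (cong₂ _+_ (count-∷ R? x xs) (count-∷ S? x xs)) ⟩
    count R? (x ∷ xs) + count S? (x ∷ xs) ∎
    where Q? = λ x → S? x ×-dec ¬? (P? x)

  two-members : {a b : A} {xs : List A} → a ∈ₗ xs → b ∈ₗ xs → a ≢ b → 2 ≤ length xs
  two-members (here refl) (here refl) a≢b = contradiction refl a≢b
  two-members (here _)    (there b∈)  _   = s≤s (∈-length b∈)
  two-members (there a∈)  (here _)    _   = s≤s (∈-length a∈)
  two-members (there a∈)  (there b∈)  a≢b = m≤n⇒m≤1+n (two-members a∈ b∈ a≢b)

  uninhabited-length : ¬ A → (xs : List A) → length xs ≡ 0
  uninhabited-length ¬A []      = refl
  uninhabited-length ¬A (x ∷ _) = contradiction x ¬A

  unsatisfiable-length : {P : A → Set} → (∀ x → ¬ P x) → {xs : List A} → All P xs → length xs ≡ 0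
  unsatisfiable-length ¬P []       = refl
  unsatisfiable-length ¬P (px ∷ _) = contradiction px (¬P _)

∑-δ : ∀ {m} (a : Fin m) → ∑[ v < m ] 𝟙 (a ≟ᶠ v) ≡ 1
∑-δ {suc m} fzero    = cong suc (sum-replicate-zero m)
∑-δ {suc m} (fsuc a) = ∑-δ a

∑-lower-bound : ∀ {m} k (f : Fin m → ℕ) → (∀ v → k ≤ f v) → m * k ≤ ∑[ v < m ] f v
∑-lower-bound {zero}  k f bound = z≤n
∑-lower-bound {suc m} k f bound =
  +-mono-≤ (bound fzero) (∑-lower-bound k (f ∘ fsuc) (bound ∘ fsuc))

∑-count : ∀ {A : Set} {m} {P : Fin m → A → Set} (P? : ∀ v → Decidable (P v)) c xs →
          All (λ x → ∑[ v < m ] 𝟙 (P? v x) ≡ c) xs →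
          ∑[ v < m ] count (P? v) xs ≡ length xs * c
∑-count {m = m} P? c []       []          = sum-replicate-zero m
∑-count {m = m} P? c (x ∷ xs) (cx ∷ cxs) = begin-equality
  ∑[ v < m ] count (P? v) (x ∷ xs)           ≡⟨ sum-cong-≗ (λ v → count-∷ (P? v) x xs) ⟩
  ∑[ v < m ] (𝟙 (P? v x) + count (P? v) xs)  ≡⟨ ∑-distrib-+ (λ v → 𝟙 (P? v x)) _ ⟩
  ∑[ v < m ] 𝟙 (P? v x) + ∑[ v < m ] count (P? v) xs
                                              ≡⟨ cong₂ _+_ cx (∑-count P? c xs cxs) ⟩
  c + length xs * c                           ∎

x∉p-x : ∀ {m} (p : Subset m) (x : Fin m) → x ∉ p - x
x∉p-x (_ ∷ p) fzero    ()
x∉p-x (_ ∷ p) (fsuc x) (there x∈) = x∉p-x p x x∈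

p-x⊆p : ∀ {m} (p : Subset m) (x : Fin m) {y : Fin m} → y ∈ p - x → y ∈ p
p-x⊆p p x = p─q⊆p p ⁅ x ⁆

All-∈-remove : ∀ {m} {p : Subset m} {x : Fin m} {zs : List (Fin m)} →
               All (x ≢_) zs → All (_∈ p) zs → All (_∈ p - x) zs
All-∈-remove x∉zs zs⊆p =
  All.zipWith (λ (x≢z , z∈p) → x∈p∧x≢y⇒x∈p-y z∈p (x≢z ∘ sym)) (x∉zs , zs⊆p)

module Incidence {n : ℕ} (G : LoopedGraph n) where

  Induced? : (X : Subset n) → Decidable (λ (e : Edge n) → proj₁ e ∈ X × proj₂ e ∈ X)
  Induced? X e = (proj₁ e ∈? X) ×-dec (proj₂ e ∈? X)

  Incident? : (w : Fin n) → Decidable (λ (e : Edge n) → proj₁ e ≡ w ⊎ proj₂ e ≡ w)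
  Incident? w e = (proj₁ e ≟ᶠ w) ⊎-dec (proj₂ e ≟ᶠ w)

  Leaving : Subset n → Fin n → Edge n → Set
  Leaving X w e = (proj₁ e ≡ w ⊎ proj₂ e ≡ w) × ¬ (proj₁ e ∈ X × proj₂ e ∈ X)

  Leaving? : (X : Subset n) (w : Fin n) → Decidable (Leaving X w)
  Leaving? X w e = Incident? w e ×-dec ¬? (Induced? X e)

  leaving : Subset n → Fin n → ℕ
  leaving X w = count (Leaving? X w) (E G)

  V : Subset n
  V = ⊤

  iE-V : iE G V ≡ length (E G)
  iE-V = cong length (filter-all (Induced? V) (All.universal (λ _ → ∈⊤ , ∈⊤) (E G)))

  iL-V : iL G V ≡ length (L G)
  iL-V = cong length (filter-all (_∈? V) (All.universal (λ _ → ∈⊤) (L G)))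

  handshake : ∑[ v < n ] deg G v ≡ length (E G) * 2 + length (L G) * 1
  handshake = begin-equality
    ∑[ v < n ] deg G v
      ≡⟨ ∑-distrib-+ (λ v → count (Incident? v) (E G)) _ ⟩
    ∑[ v < n ] count (Incident? v) (E G) + ∑[ v < n ] count (λ l → l ≟ᶠ v) (L G)
      ≡⟨ cong₂ _+_ (∑-count Incident? 2 (E G) (All.map edge-incidences (E-proper G)))
                   (∑-count (λ v l → l ≟ᶠ v) 1 (L G) (All.universal ∑-δ (L G))) ⟩
    length (E G) * 2 + length (L G) * 1 ∎
    where
    edge-incidences : ∀ {e : Edge n} → toℕ (proj₁ e) < toℕ (proj₂ e) →
                      ∑[ v < n ] 𝟙 (Incident? v e) ≡ 2
    edge-incidences {a , b} a<b = begin-equality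
      ∑[ v < n ] 𝟙 (Incident? v (a , b))      ≡⟨ sum-cong-≗ (λ v → 𝟙-⊎ (a ≟ᶠ v) (b ≟ᶠ v) not-both) ⟩
      ∑[ v < n ] (𝟙 (a ≟ᶠ v) + 𝟙 (b ≟ᶠ v))    ≡⟨ ∑-distrib-+ (λ v → 𝟙 (a ≟ᶠ v)) _ ⟩
      ∑[ v < n ] 𝟙 (a ≟ᶠ v) + ∑[ v < n ] 𝟙 (b ≟ᶠ v) ≡⟨ cong₂ _+_ (∑-δ a) (∑-δ b) ⟩
      2                                        ∎
      where
      not-both : ∀ {v} → ¬ (a ≡ v × b ≡ v)
      not-both (a≡v , b≡v) = <-irrefl (cong toℕ (trans a≡v (sym b≡v))) a<b

  peel : ∀ X w → iEL G X + leaving X w ≤ iEL G (X - w) + deg G w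
  peel X w = begin
    (iE G X + iL G X) + leaving X w   ≡⟨ xy∙z≈xz∙y (iE G X) _ _ ⟩
    (iE G X + leaving X w) + iL G X   ≤⟨ +-mono-≤ edges loops ⟩
    (iE G (X - w) + count (Incident? w) (E G)) + (iL G (X - w) + count (λ l → l ≟ᶠ w) (L G))
                                      ≡⟨ interchange (iE G (X - w)) _ _ _ ⟩
    iEL G (X - w) + deg G w           ∎
    where
    stays : ∀ {y} → y ∈ X → y ≢ w → y ∈ X - w
    stays = x∈p∧x≢y⇒x∈p-y
    edges : iE G X + leaving X w ≤ iE G (X - w) + count (Incident? w) (E G)
    edges = count-cover (Induced? X) (Induced? (X - w)) (Incident? w)
      (λ _ (a∈ , b∈) not-at-w → stays a∈ (not-at-w ∘ inj₁) , stays b∈ (not-at-w ∘ inj₂)) (E G)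
    loops : iL G X ≤ iL G (X - w) + count (λ l → l ≟ᶠ w) (L G)
    loops = ≤-trans (m≤m+n _ _)
      (count-cover (_∈? X) (_∈? (X - w)) (λ l → l ≟ᶠ w) (λ _ → stays) (L G))

  peel-deg3 : ∀ {X w j} → InV3 G w → j ≤ leaving X w → iEL G X + j ≤ iEL G (X - w) + 3
  peel-deg3 {X} {w} {j} deg≡3 j≤out = begin
    iEL G X + j              ≤⟨ +-monoʳ-≤ (iEL G X) j≤out ⟩
    iEL G X + leaving X w    ≤⟨ peel X w ⟩
    iEL G (X - w) + deg G w  ≡⟨ cong (iEL G (X - w) +_) deg≡3 ⟩
    iEL G (X - w) + 3        ∎

  Joins : Edge n → Fin n → Fin n → Set
  Joins e x y = e ≡ (x , y) ⊎ e ≡ (y , x)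

  adjacent-edge : ∀ {x y} → Adj G x y → ∃ λ e → e ∈ₗ E G × Joins e x y
  adjacent-edge (inj₁ xy∈) = _ , xy∈ , inj₁ refl
  adjacent-edge (inj₂ yx∈) = _ , yx∈ , inj₂ refl

  joins-sym : ∀ {e x y} → Joins e x y → Joins e y x
  joins-sym (inj₁ eq) = inj₂ eq
  joins-sym (inj₂ eq) = inj₁ eq

  joins-leaving : ∀ {X e p w} → Joins e p w → p ∉ X → Leaving X w e
  joins-leaving (inj₁ refl) p∉ = inj₂ refl , p∉ ∘ proj₁
  joins-leaving (inj₂ refl) p∉ = inj₁ refl , p∉ ∘ proj₂

  joins-injective : ∀ {e p v w} → Joins e p w → Joins e v w → p ≡ v
  joins-injective (inj₁ refl) (inj₁ eq) = cong proj₁ eq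
  joins-injective (inj₁ refl) (inj₂ eq) = trans (cong proj₁ eq) (cong proj₂ eq)
  joins-injective (inj₂ refl) (inj₁ eq) = trans (cong proj₂ eq) (cong proj₁ eq)
  joins-injective (inj₂ refl) (inj₂ eq) = cong proj₂ eq

  leaving-one : ∀ {X p w} → Adj G p w → p ∉ X → 1 ≤ leaving X w
  leaving-one {X} {p} {w} adj p∉ with adjacent-edge adj
  ... | e , e∈ , joins = ∈-length (∈-filter⁺ (Leaving? X w) e∈ (joins-leaving joins p∉))

  leaving-two : ∀ {X p w v} → Adj G p w → Adj G w v → p ∉ X → v ∉ X → p ≢ v → 2 ≤ leaving X w
  leaving-two {X} {p} {w} {v} adj₁ adj₂ p∉ v∉ p≢v
    with adjacent-edge adj₁ | adjacent-edge adj₂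
  ... | e₁ , e₁∈ , joins₁ | e₂ , e₂∈ , joins₂ =
    two-members (∈-filter⁺ (Leaving? X w) e₁∈ (joins-leaving joins₁ p∉))
                (∈-filter⁺ (Leaving? X w) e₂∈ (joins-leaving (joins-sym joins₂) v∉))
                (λ { refl → p≢v (joins-injective joins₁ (joins-sym joins₂)) })

  -- Peeling a path p w₁ … w_k v of degree-3 vertices out of X, where the
  -- ends p and v lie outside X and (if k = 1) are distinct: every w_i has
  -- a neighbour outside the current set and w_k has two, so the result Y
  -- retains all but at most 2k − 1 of the incidences of X.
  peel-path : ∀ {v X p w} (ws : List (Fin n)) → p ∉ X → v ∉ X → p ≢ v ⊎ ws ≢ [] →
              All (_∈ X) (w ∷ ws) → Unique (w ∷ ws) → All (InV3 G) (w ∷ ws) →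
              Linked (Adj G) (p ∷ w ∷ ws ++ [ v ]) →
              ∃ λ Y → v ∉ Y × iEL G X < iEL G Y + 2 * length (w ∷ ws)
                            × ∣ Y ∣ + length (w ∷ ws) ≤ ∣ X ∣
  peel-path {v} {X} {p} {w} [] p∉ v∉ ends (w∈ ∷ []) _ (deg₃ ∷ []) (p~w ∷ w~v ∷ [-]) =
    X - w , v∉ ∘ p-x⊆p X w , incidences , size
    where
    p≢v : p ≢ v
    p≢v = fromInj₁ (λ []≢[] → contradiction refl []≢[]) ends
    loses-at-most-1 : iEL G X ≤ iEL G (X - w) + 1
    loses-at-most-1 = ≤-cancel-+ (iEL G X) (iEL G (X - w)) 1 2
      (peel-deg3 deg₃ (leaving-two p~w w~v p∉ v∉ p≢v))
    incidences : iEL G X < iEL G (X - w) + 2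
    incidences = subst (iEL G X <_) (sym (+-suc (iEL G (X - w)) 1)) (s≤s loses-at-most-1)
    size : ∣ X - w ∣ + 1 ≤ ∣ X ∣
    size = subst (_≤ ∣ X ∣) (+-comm 1 ∣ X - w ∣) (x∈p⇒∣p-x∣<∣p∣ w∈)
  peel-path {v} {X} {w = w} (w′ ∷ ws) p∉ v∉ _ (w∈ ∷ ws⊆X) (w∉ws ∷ unique)
            (deg₃ ∷ degs₃) (p~w ∷ path)
    with peel-path ws (x∉p-x X w) (v∉ ∘ p-x⊆p X w) (inj₁ w≢v)
                   (All-∈-remove w∉ws ws⊆X) unique degs₃ path
    where w≢v : w ≢ v
          w≢v refl = v∉ w∈
  ... | Y , v∉Y , rest-incidences , rest-size = Y , v∉Y , incidences , size
    where
    k = length (w′ ∷ ws)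
    loses-at-most-2 : iEL G X ≤ iEL G (X - w) + 2
    loses-at-most-2 = ≤-cancel-+ (iEL G X) (iEL G (X - w)) 2 1
      (peel-deg3 deg₃ (leaving-one p~w p∉))
    incidences : iEL G X < iEL G Y + 2 * suc k
    incidences = begin-strict
      iEL G X                  ≤⟨ loses-at-most-2 ⟩
      iEL G (X - w) + 2        <⟨ +-monoˡ-< 2 rest-incidences ⟩
      iEL G Y + 2 * k + 2      ≡⟨ +-assoc (iEL G Y) (2 * k) 2 ⟩
      iEL G Y + (2 * k + 2)    ≡⟨ cong (iEL G Y +_) (trans (+-comm (2 * k) 2) (sym (*-suc 2 k))) ⟩
      iEL G Y + 2 * suc k      ∎
    size : ∣ Y ∣ + suc k ≤ ∣ X ∣
    size = begin
      ∣ Y ∣ + suc k      ≡⟨ +-suc ∣ Y ∣ k ⟩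
      suc (∣ Y ∣ + k)    ≤⟨ s≤s rest-size ⟩
      suc ∣ X - w ∣      ≤⟨ x∈p⇒∣p-x∣<∣p∣ w∈ ⟩
      ∣ X ∣              ∎

-- A rigid circuit has at most 2n − 2 non-loop edges: for n ≥ 2 this is
-- the sparsity of E on V, a single vertex carries no non-loop edge, and
-- the empty graph cannot have 2·0 + 1 edges and loops.
few-edges : ∀ {n} (G : LoopedGraph n) → RigidCircuit G → length (E G) + 2 ≤ 2 * n
few-edges {zero} G circuit = contradiction no-edges-nor-loops 0≢1+n
  where
  no-edges-nor-loops : 0 ≡ 1
  no-edges-nor-loops = trans (sym (cong₂ _+_ (uninhabited-length (λ { (() , _) }) (E G))
                                       (uninhabited-length (λ ()) (L G))))
                        (RigidCircuit.count circuit)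
few-edges {suc zero} G circuit =
  subst (λ k → k + 2 ≤ 2) (sym (unsatisfiable-length (λ { (fzero , fzero) () }) (E-proper G))) ≤-refl
few-edges {suc (suc m)} G circuit = begin
  length (E G) + 2  ≤⟨ +-monoʳ-≤ (length (E G)) (n≤1+n 2) ⟩
  length (E G) + 3  ≡⟨ cong (_+ 3) (sym iE-V) ⟩
  iE G V + 3        ≤⟨ RigidCircuit.sparseE circuit V (subst (2 ≤_) (sym (∣⊤∣≡n n)) (s≤s (s≤s z≤n))) ⟩
  2 * ∣ V ∣         ≡⟨ cong (2 *_) (∣⊤∣≡n n) ⟩
  2 * n             ∎
  where
  n = suc (suc m)
  open Incidence G

module Circuit {n : ℕ} (G : LoopedGraph n) (circuit : RigidCircuit G) where
  open Incidence G
  open RigidCircuit circuit using (sparseEL) renaming (count to edges+loops)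

  iEL-V : iEL G V ≡ 2 * n + 1
  iEL-V = trans (cong₂ _+_ iE-V iL-V) edges+loops

  complement-size : ∀ w → 2 * ∣ V - w ∣ + 2 ≤ 2 * n
  complement-size w = subst (_≤ 2 * n) (*-distribˡ-+ 2 ∣ V - w ∣ 1) (*-monoʳ-≤ 2 size)
    where
    size : ∣ V - w ∣ + 1 ≤ n
    size = subst₂ _≤_ (+-comm 1 ∣ V - w ∣) (∣⊤∣≡n n) (x∈p⇒∣p-x∣<∣p∣ (∈⊤ {x = w}))

  peel-from-V : ∀ w → 2 * n + 1 ≤ iEL G (V - w) + deg G w
  peel-from-V w = begin
    2 * n + 1                      ≡⟨ sym iEL-V ⟩
    iEL G V                        ≤⟨ m≤m+n (iEL G V) (leaving V w) ⟩
    iEL G V + leaving V w          ≤⟨ peel V w ⟩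
    iEL G (V - w) + deg G w        ∎

  min-degree : ∀ w → 3 ≤ deg G w
  min-degree w = +-cancelˡ-≤ (2 * x) 3 (deg G w) (begin
    2 * x + 3                ≡⟨ sym (+-assoc (2 * x) 2 1) ⟩
    2 * x + 2 + 1            ≤⟨ +-monoˡ-≤ 1 (complement-size w) ⟩
    2 * n + 1                ≤⟨ peel-from-V w ⟩
    iEL G (V - w) + deg G w  ≤⟨ +-monoˡ-≤ (deg G w) (sparseEL (V - w) (w , x∉p-x V w)) ⟩
    2 * x + deg G w          ∎)
    where x = ∣ V - w ∣

  -- If every degree were at least 4, the handshake lemma would give
  -- 4n ≤ 2|E| + |L| = |E| + (2n + 1) ≤ 4n − 1.
  not-all-degrees-≥4 : ¬ (∀ w → 4 ≤ deg G w)
  not-all-degrees-≥4 all≥4 = contradiction (+-cancelˡ-≤ (n * 4) 2 1 (begin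
    n * 4 + 2                        ≤⟨ +-monoˡ-≤ 2 (subst (n * 4 ≤_) handshake (∑-lower-bound 4 (deg G) all≥4)) ⟩
    e * 2 + l * 1 + 2                ≡⟨ regroup e l ⟩
    (e + 2) + (e + l)                ≤⟨ +-mono-≤ (few-edges G circuit) (≤-reflexive edges+loops) ⟩
    2 * n + (2 * n + 1)              ≡⟨ collect n ⟩
    n * 4 + 1                        ∎)) λ { (s≤s ()) }
    where
    e = length (E G)
    l = length (L G)
    regroup : ∀ e l → e * 2 + l * 1 + 2 ≡ (e + 2) + (e + l)
    regroup = solve-∀
    collect : ∀ n → 2 * n + (2 * n + 1) ≡ n * 4 + 1
    collect = solve-∀

  deg3-exists : ∃ λ v → InV3 G v
  deg3-exists with any? (λ v → deg G v ≟ 3)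
  ... | yes found = found
  ... | no none   = ⊥-elim (not-all-degrees-≥4 (λ w →
                      ≤∧≢⇒< (min-degree w) (λ 3≡deg → none (w , sym 3≡deg))))

  -- Part 2: a cycle v w₁ … w_k v (k ≥ 2) in V₃ is impossible.  Peeling v
  -- from V and then the path w₁ … w_k leaves a set Y ∌ v with more than
  -- 2|Y| incidences.
  forest : V3Forest G
  forest record { rest = [] ; long = () }
  forest record { rest = _ ∷ [] ; long = s≤s () }
  forest record { v = v ; rest = w ∷ w′ ∷ ws ; dist = v∉rest ∷ unique
                ; inV3 = deg₃ ∷ degs₃ ; walk = walk }
    with peel-path (w′ ∷ ws) (x∉p-x V v) (x∉p-x V v) (inj₂ λ ())
                   (All-∈-remove v∉rest (All.universal (λ _ → ∈⊤) (w ∷ w′ ∷ ws)))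
                   unique degs₃ walk
  ... | Y , v∉Y , incidences , size = <-irrefl refl (begin-strict
    2 * n + 1                 ≤⟨ peel-from-V v ⟩
    iEL G (V - v) + deg G v   ≡⟨ cong (iEL G (V - v) +_) deg₃ ⟩
    iEL G (V - v) + 3         <⟨ +-monoˡ-< 3 incidences ⟩
    iEL G Y + 2 * k + 3       ≤⟨ +-monoˡ-≤ 3 (+-monoˡ-≤ (2 * k) (sparseEL Y (v , v∉Y))) ⟩
    2 * ∣ Y ∣ + 2 * k + 3     ≡⟨ cong (_+ 3) (sym (*-distribˡ-+ 2 ∣ Y ∣ k)) ⟩
    2 * (∣ Y ∣ + k) + 3       ≤⟨ +-monoˡ-≤ 3 (*-monoʳ-≤ 2 size) ⟩
    2 * ∣ V - v ∣ + 3         ≡⟨ sym (+-assoc (2 * ∣ V - v ∣) 2 1) ⟩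
    2 * ∣ V - v ∣ + 2 + 1     ≤⟨ +-monoˡ-≤ 1 (complement-size v) ⟩
    2 * n + 1                 ∎)
    where k = length (w ∷ w′ ∷ ws)

lemma5p2 : ∀ {n : ℕ} (G : LoopedGraph n) → RigidCircuit G →
             (∃ λ v → InV3 G v) × V3Forest G
lemma5p2 G circuit = Circuit.deg3-exists G circuit , Circuit.forest G circuit
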